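{- Let $\Omega$ be a set and $q$ a set of operations on $\Omega$. Then: (1) A relation $R\subseteq\Omega^k$ is definable in $\mathscr{L}^-_{\infty\infty}(q)$ with parameters from $\Omega$ if and only if $R$ is invariant under $\sim_q$. (2) For every quantifier $Q$ on $\Omega$, $Q^{\upharpoonright q}=\cup(Q/\sim_q)$.
   Context: A set of operations $q$ on $\Omega$ is a set of first-order relations (subsets of $\Omega^k$, $k$ finite) and quantifiers on $\Omega$, where a quantifier of type $(k_1,\dots,k_l)$ is a subset of $\mathcal P(\Omega^{k_1})\times\dots\times\mathcal P(\Omega^{k_l})$. $\mathscr{L}^-_{\infty\infty}(q)$ is the equality-free infinitary logic (arbitrary conjunctions/disjunctions, quantification over arbitrarily long sequences of variables, no equality symbol) with a predicate symbol for each relation of $q$ and a generalized quantifier symbol for each $Q\in q$, where $Q\bar x_1\dots\bar x_l(\varphi_1,\dots,\varphi_l)$ holds iff $(\|\varphi_1\|,\dots,\|\varphi_l\|)\in Q$, $\|\varphi_i\|\subseteq\Omega^{k_i}$ being the set of tuples satisfying $\varphi_i$ in the bound variables $\bar x_i$. $a\sim_q b$ iff for every formula $\varphi(x,\bar x)$ of $\mathscr{L}^-_{\infty\infty}(q)$ ($\bar x$ possibly infinite), $\Omega,q\models\forall\bar x(\varphi(a,\bar x)\leftrightarrow\varphi(b,\bar x))$; this is an equivalence relation. $R$ is invariant under an equivalence $\sim$ if $\bar a\in R$ and $\bar a\sim\bar b$ componentwise imply $\bar b\in R$. For a quantifier $Q$, $Q^{\upharpoonright q}$ is the set of $(R_1,\dots,R_l)\in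 Q$ such that each $R_i$ is definable in $\mathscr{L}^-_{\infty\infty}(q)$ with parameters from $\Omega$. For an equivalence $\sim$ with classes $[a]$ and quotient $\Omega/\sim$: for $R'\subseteq(\Omega/\sim)^k$, $\cup R'=\{\bar a\in\Omega^k: ([a_1],\dots,[a_k])\in R'\}$; for a quantifier $Q$ on $\Omega$, $Q/\sim=\{(R'_1,\dots,R'_l): (\cup R'_1,\dots,\cup R'_l)\in Q\}$ (a quantifier on $\Omega/\sim$); for a quantifier $Q'$ on $\Omega/\sim$, $\cup Q'=\{(\cup R'_1,\dots,\cup R'_l):(R'_1,\dots,R'_l)\in Q'\}$. -}

module Defs where

open import Level using (Level; _⊔_) renaming (suc to lsuc; zero to lzero)
open import Data.Nat using (ℕ)
open import Data.Fin using (Fin)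
open import Data.Vec using (Vec; lookup)
open import Data.Sum using (_⊎_; [_,_])
open import Data.Product using (Σ; Σ-syntax; _×_)
open import Data.Unit using (⊤)
open import Relation.Nullary using (¬_)
open import Function using (const)
open import Function.Bundles using (_⇔_)
open import Data.Vec.Relation.Binary.Pointwise.Inductive using (Pointwise)

RelOn : Set → ℕ → Set₁
RelOn Ω k = Vec Ω k → Set

Quantifier : (Ω : Set) {l : ℕ} → (Fin l → ℕ) → Set₁
Quantifier Ω {l} ks = ((i : Fin l) → RelOn Ω (ks i)) → Set

-- Quantifiers are sets of tuples of *sets*, hence respect extensional
-- equality of their arguments.
IsExtensional : {Ω : Set} {l : ℕ} {ks : Fin l → ℕ} → Quantifier Ω ks → Set₁
IsExtensional {Ω} {l} {ks} Q =
  (R S : (i : Fin l) → RelOn Ω (ks i)) →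
  ((i : Fin l) (v : Vec Ω (ks i)) → R i v ⇔ S i v) → Q R → Q S

record Ops (Ω : Set) : Set₁ where
  field
    RI     : Set
    rarity : RI → ℕ
    rel    : (r : RI) → RelOn Ω (rarity r)
    QI     : Set
    qlen   : QI → ℕ
    qtype  : (j : QI) → Fin (qlen j) → ℕ
    quant  : (j : QI) → Quantifier Ω (qtype j)
    quant-ext : (j : QI) → IsExtensional (quant j)

module _ {Ω : Set} (q : Ops Ω) where
  open Ops q

  -- Formulas of the equality-free infinitary logic L⁻_∞∞(q) whose free
  -- variables are among V (an arbitrary set of variables).
  data Formula : Set → Set₁ where
    rel′  : {V : Set} (r : RI) → (Fin (rarity r) → V) → Formula V
    neg   : {V : Set} → Formula V → Formula V
    conj  : {V : Set} (I : Set) → (I → Formula V) → Formula V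
    disj  : {V : Set} (I : Set) → (I → Formula V) → Formula V
    all   : {V : Set} (W : Set) → Formula (V ⊎ W) → Formula V
    ex    : {V : Set} (W : Set) → Formula (V ⊎ W) → Formula V
    quant′ : {V : Set} (j : QI) →
             ((i : Fin (qlen j)) → Formula (V ⊎ Fin (qtype j i))) → Formula V

  Sat : {V : Set} → Formula V → (V → Ω) → Set
  Sat (rel′ r t) ρ = rel r (Data.Vec.tabulate (λ m → ρ (t m)))
  Sat (neg φ) ρ = ¬ Sat φ ρ
  Sat (conj I φ) ρ = (i : I) → Sat (φ i) ρ
  Sat (disj I φ) ρ = Σ[ i ∈ I ] Sat (φ i) ρ
  Sat (all W φ) ρ = (σ : W → Ω) → Sat φ [ ρ , σ ]
  Sat (ex W φ) ρ = Σ[ σ ∈ (W → Ω) ] Sat φ [ ρ , σ ]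
  Sat (quant′ j φ) ρ = quant j (λ i w → Sat (φ i) [ ρ , lookup w ])

  Definable : {k : ℕ} → RelOn Ω k → Set₁
  Definable {k} R =
    Σ[ P ∈ Set ] Σ[ φ ∈ Formula (Fin k ⊎ P) ] Σ[ p ∈ (P → Ω) ]
      ((v : Vec Ω k) → R v ⇔ Sat φ [ lookup v , p ])

  _∼_ : Ω → Ω → Set₁
  a ∼ b = (V : Set) (φ : Formula (⊤ ⊎ V)) (ρ : V → Ω) →
          Sat φ [ const a , ρ ] ⇔ Sat φ [ const b , ρ ]

  Restrict : {l : ℕ} {ks : Fin l → ℕ} → Quantifier Ω ks →
             ((i : Fin l) → RelOn Ω (ks i)) → Set₁
  Restrict {l} Q R = Q R × ((i : Fin l) → Definable (R i))

Invariant : {Ω : Set} {ℓ : Level} → (Ω → Ω → Set ℓ) → {k : ℕ} → RelOn Ω k → Set ℓ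
Invariant _≈_ {k} R = ∀ a b → R a → Pointwise _≈_ a b → R b

-- Quotient Ω/≈ is represented via the setoid (Ω, ≈): a k-ary relation on
-- Ω/≈ is a ≈-invariant relation on Ω (bijective correspondence).
QRel : {Ω : Set} {ℓ : Level} → (Ω → Ω → Set ℓ) → ℕ → Set (lsuc lzero ⊔ ℓ)
QRel {Ω} _≈_ k = Σ[ R ∈ RelOn Ω k ] Invariant _≈_ R

cupRel : {Ω : Set} {ℓ : Level} {_≈_ : Ω → Ω → Set ℓ} {k : ℕ} → QRel _≈_ k → RelOn Ω k
cupRel R′ = Data.Product.proj₁ R′

QQuantifier : {Ω : Set} {ℓ : Level} → (Ω → Ω → Set ℓ) → {l : ℕ} → (Fin l → ℕ) → Set (lsuc lzero ⊔ ℓ)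
QQuantifier _≈_ {l} ks = ((i : Fin l) → QRel _≈_ (ks i)) → Set

quotQ : {Ω : Set} {ℓ : Level} (_≈_ : Ω → Ω → Set ℓ) {l : ℕ} {ks : Fin l → ℕ} →
        Quantifier Ω ks → QQuantifier _≈_ ks
quotQ _≈_ Q R′ = Q (λ i → cupRel (R′ i))

-- ∪Q' (as a set of tuples of relations on Ω, i.e. up to extensional equality)
cupQ : {Ω : Set} {ℓ : Level} {_≈_ : Ω → Ω → Set ℓ} {l : ℕ} {ks : Fin l → ℕ} →
       QQuantifier _≈_ ks → ((i : Fin l) → RelOn Ω (ks i)) → Set (lsuc lzero ⊔ ℓ)
cupQ {Ω} {_≈_ = _≈_} {l} {ks} Q′ R =
  Σ[ R′ ∈ ((i : Fin l) → QRel _≈_ (ks i)) ]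
    (Q′ R′ × ((i : Fin l) (v : Vec Ω (ks i)) → R i v ⇔ cupRel (R′ i) v))

module Submission where

-- (1, ⇒)  Renaming variables does not change satisfaction (given that the
--         assignments agree along the renaming).  Hence a single free variable
--         can be split off, or hidden among the parameters, and the defining
--         property of ∼_q lets us replace the entries of a tuple one at a time
--         by ∼_q-equivalent ones: every definable relation is ∼_q-invariant.
-- (1, ⇐)  Classically, whenever a ≁ b some formula with parameters holds of a
--         and fails of b.  Choosing one such "test" for every pair (a , b),
--         with the parameters of all tests pooled into one parameter set, the
--         formula ⋁_{c ∈ R} ⋀_{i, b} test(c_i , b)(x_i) holds of v exactly when
--         v is pointwise ∼_q-equivalent to some c ∈ R, i.e. (by invariance)
--         exactly when v ∈ R.
-- (2)     A tuple in Q^{↾q} consists of definable, hence invariant, relations,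
--         i.e. of relations on Ω/∼_q; conversely the invariant relations of a
--         tuple in ∪(Q/∼_q) are definable by (1).

open import Defs
open import Level using (Level)
open import Data.Nat using (ℕ; zero; suc)
open import Data.Fin using (Fin; zero; suc)
open import Data.Vec using (Vec; _∷_; lookup)
open import Data.Vec.Properties using (tabulate-cong)
open import Data.Vec.Relation.Binary.Pointwise.Inductive using (Pointwise; []; _∷_)
open import Data.Vec.Relation.Binary.Pointwise.Extensional using (ext; extensional⇒inductive)
open import Data.Product using (Σ; Σ-syntax; _×_; _,_; proj₁; proj₂)
open import Data.Sum using (_⊎_; inj₁; inj₂; [_,_]; map₁)
open import Data.Unit using (⊤; tt)
open import Data.Empty using (⊥; ⊥-elim)
open import Relation.Nullary using (¬_; yes; no)
open import Relation.Binary.PropositionalEquality using (_≡_; refl; subst; sym)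
open import Function using (const; id; _∘_)
open import Function.Bundles using (_⇔_; mk⇔; Equivalence)
open import Function.Construct.Symmetry using (⇔-sym)
open import Function.Construct.Composition using (_⇔-∘_)
open import Function.Related.TypeIsomorphisms using (¬-cong-⇔)
open import Axiom.ExcludedMiddle using (ExcludedMiddle)
open import Axiom.DoubleNegationElimination using (em⇒dne)

open Equivalence using (to; from)

Π-cong-⇔ : {I : Set} {A B : I → Set} → ((i : I) → A i ⇔ B i) →
           ((i : I) → A i) ⇔ ((i : I) → B i)
Π-cong-⇔ e = mk⇔ (λ f i → to (e i) (f i)) (λ g i → from (e i) (g i))

Σ-cong-⇔ : {I : Set} {A B : I → Set} → ((i : I) → A i ⇔ B i) →
           (Σ I A) ⇔ (Σ I B)
Σ-cong-⇔ e = mk⇔ (λ (i , a) → i , to (e i) a) (λ (i , b) → i , from (e i) b)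

module _ {Ω : Set} (q : Ops Ω) where
  open Ops q

  rename : {V V′ : Set} → (V → V′) → Formula q V → Formula q V′
  rename f (rel′ r t)   = rel′ r (λ m → f (t m))
  rename f (neg φ)      = neg (rename f φ)
  rename f (conj I φ)   = conj I (λ i → rename f (φ i))
  rename f (disj I φ)   = disj I (λ i → rename f (φ i))
  rename f (all W φ)    = all W (rename (map₁ f) φ)
  rename f (ex W φ)     = ex W (rename (map₁ f) φ)
  rename f (quant′ j φ) = quant′ j (λ i → rename (map₁ f) (φ i))

  Agree : {V V′ : Set} → (V → V′) → (V → Ω) → (V′ → Ω) → Set
  Agree f ρ ρ′ = ∀ v → ρ′ (f v) ≡ ρ v

  agree-⊎ : {V V′ W : Set} {f : V → V′} {ρ : V → Ω} {ρ′ : V′ → Ω} (σ : W → Ω) →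
            Agree f ρ ρ′ → Agree (map₁ f) [ ρ , σ ] [ ρ′ , σ ]
  agree-⊎ σ h (inj₁ v) = h v
  agree-⊎ σ h (inj₂ w) = refl

  -- Satisfaction of a renamed formula is satisfaction of the original one
  -- under the pulled-back assignment.  (The quantifier case is where the
  -- extensionality of the quantifiers of q is needed.)
  rename-sat : {V V′ : Set} (f : V → V′) (φ : Formula q V) {ρ : V → Ω} {ρ′ : V′ → Ω} →
               Agree f ρ ρ′ → Sat q (rename f φ) ρ′ ⇔ Sat q φ ρ
  rename-sat f (rel′ r t) h = mk⇔ (subst (rel r) e) (subst (rel r) (sym e))
    where e = tabulate-cong (λ m → h (t m))
  rename-sat f (neg φ) h = ¬-cong-⇔ (rename-sat f φ h)
  rename-sat f (conj I φ) h = Π-cong-⇔ (λ i → rename-sat f (φ i) h)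
  rename-sat f (disj I φ) h = Σ-cong-⇔ (λ i → rename-sat f (φ i) h)
  rename-sat f (all W φ) h = Π-cong-⇔ (λ σ → rename-sat (map₁ f) φ (agree-⊎ σ h))
  rename-sat f (ex W φ) h = Σ-cong-⇔ (λ σ → rename-sat (map₁ f) φ (agree-⊎ σ h))
  rename-sat f (quant′ j φ) h =
    mk⇔ (quant-ext j _ _ e) (quant-ext j _ _ (λ i w → ⇔-sym (e i w)))
    where
    e : ∀ i w → Sat q (rename (map₁ f) (φ i)) [ _ , lookup w ] ⇔ Sat q (φ i) [ _ , lookup w ]
    e i w = rename-sat (map₁ f) (φ i) (agree-⊎ (lookup w) h)

  assign : {k : ℕ} {P : Set} → Vec Ω k → (P → Ω) → Fin k ⊎ P → Ω
  assign v p = [ lookup v , p ]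

  split-head : {k : ℕ} {P : Set} → Fin (suc k) ⊎ P → ⊤ ⊎ (Fin k ⊎ P)
  split-head (inj₁ zero)    = inj₁ tt
  split-head (inj₁ (suc i)) = inj₂ (inj₁ i)
  split-head (inj₂ p)       = inj₂ (inj₂ p)

  split-head-agree : {k : ℕ} {P : Set} (a : Ω) (v : Vec Ω k) (p : P → Ω) →
                     Agree split-head (assign (a ∷ v) p) [ const a , assign v p ]
  split-head-agree a v p (inj₁ zero)    = refl
  split-head-agree a v p (inj₁ (suc i)) = refl
  split-head-agree a v p (inj₂ _)       = refl

  hide-head : {k : ℕ} {P : Set} → Fin (suc k) ⊎ P → Fin k ⊎ (⊤ ⊎ P)
  hide-head (inj₁ zero)    = inj₂ (inj₁ tt)
  hide-head (inj₁ (suc i)) = inj₁ i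
  hide-head (inj₂ p)       = inj₂ (inj₂ p)

  hide-head-agree : {k : ℕ} {P : Set} (a : Ω) (v : Vec Ω k) (p : P → Ω) →
                    Agree hide-head (assign (a ∷ v) p) (assign v [ const a , p ])
  hide-head-agree a v p (inj₁ zero)    = refl
  hide-head-agree a v p (inj₁ (suc i)) = refl
  hide-head-agree a v p (inj₂ _)       = refl

  replace-head : {k : ℕ} {P : Set} (φ : Formula q (Fin (suc k) ⊎ P)) (p : P → Ω)
                 {a b : Ω} (v : Vec Ω k) → _∼_ q a b →
                 Sat q φ (assign (a ∷ v) p) → Sat q φ (assign (b ∷ v) p)
  replace-head φ p {a} {b} v a∼b =
    to (rename-sat split-head φ (split-head-agree b v p))
    ∘ to (a∼b _ (rename split-head φ) (assign v p))
    ∘ from (rename-sat split-head φ (split-head-agree a v p))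

  -- Satisfaction is preserved by replacing a tuple by a pointwise
  -- ∼_q-equivalent one (induction on the length, hiding the head).
  transport : {k : ℕ} {P : Set} (φ : Formula q (Fin k ⊎ P)) (p : P → Ω) {a b : Vec Ω k} →
              Pointwise (_∼_ q) a b → Sat q φ (assign a p) → Sat q φ (assign b p)
  transport φ p [] s = s
  transport φ p {x ∷ as} {y ∷ bs} (x∼y ∷ as∼bs) s =
    to (rename-sat hide-head φ (hide-head-agree y bs p))
      (transport (rename hide-head φ) [ const y , p ] as∼bs
        (from (rename-sat hide-head φ (hide-head-agree y as p))
          (replace-head φ p as x∼y s)))

  definable⇒invariant : {k : ℕ} (R : Vec Ω k → Set) → Definable q R → Invariant (_∼_ q) R
  definable⇒invariant R (P , φ , p , R⇔φ) a b Ra a∼b =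
    from (R⇔φ b) (transport φ p a∼b (to (R⇔φ a) Ra))

  record Test (a b : Ω) : Set₁ where
    field
      Par     : Set
      formula : Formula q (⊤ ⊎ Par)
      params  : Par → Ω
      holds   : Sat q formula [ const a , params ]
      sound   : Sat q formula [ const b , params ] → _∼_ q a b

  module Classical (em : {ℓ : Level} → ExcludedMiddle ℓ) where

    Separator : Ω → Ω → Set₁
    Separator a b = Σ[ V ∈ Set ] Σ[ φ ∈ Formula q (⊤ ⊎ V) ] Σ[ ρ ∈ (V → Ω) ]
      (Sat q φ [ const a , ρ ] × ¬ Sat q φ [ const b , ρ ])

    -- If no formula separates a from b (in either order, using negation),
    -- then a ∼_q b.
    separate : (a b : Ω) → ¬ _∼_ q a b → Separator a b
    separate a b a≁b = em⇒dne em λ ¬sep → a≁b λ V φ ρ → mk⇔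
      (λ φa → em⇒dne em λ ¬φb → ¬sep (V , φ , ρ , φa , ¬φb))
      (λ φb → em⇒dne em λ ¬φa → ¬sep (V , neg φ , ρ , ¬φa , λ ¬φb → ¬φb φb))

    test : (a b : Ω) → Test a b
    test a b with em {P = _∼_ q a b}
    ... | yes a∼b = record { Par = ⊥ ; formula = conj ⊥ λ () ; params = λ ()
                           ; holds = λ () ; sound = λ _ → a∼b }
    ... | no a≁b with separate a b a≁b
    ...   | V , φ , ρ , φa , ¬φb = record { Par = V ; formula = φ ; params = ρ
                                          ; holds = φa ; sound = λ φb → ⊥-elim (¬φb φb) }

    open Test

    TestPar : Set
    TestPar = Σ[ a ∈ Ω ] Σ[ b ∈ Ω ] Par (test a b)

    testParams : TestPar → Ω
    testParams (a , b , v) = params (test a b) v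

    place : {k : ℕ} (i : Fin k) (a b : Ω) → ⊤ ⊎ Par (test a b) → Fin k ⊎ TestPar
    place i a b (inj₁ _) = inj₁ i
    place i a b (inj₂ v) = inj₂ (a , b , v)

    place-agree : {k : ℕ} (v : Vec Ω k) (i : Fin k) (a b : Ω) →
                  Agree (place i a b) [ const (lookup v i) , params (test a b) ]
                        (assign v testParams)
    place-agree v i a b (inj₁ _) = refl
    place-agree v i a b (inj₂ _) = refl

    testAt : {k : ℕ} → Fin k → Ω → Ω → Formula q (Fin k ⊎ TestPar)
    testAt i a b = rename (place i a b) (formula (test a b))

    testAt-sat : {k : ℕ} (v : Vec Ω k) (i : Fin k) (a b : Ω) →
                 Sat q (testAt i a b) (assign v testParams) ⇔
                 Sat q (formula (test a b)) [ const (lookup v i) , params (test a b) ]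
    testAt-sat v i a b = rename-sat (place i a b) (formula (test a b)) (place-agree v i a b)

    near : {k : ℕ} → Vec Ω k → Formula q (Fin k ⊎ TestPar)
    near c = conj (Fin _ × Ω) (λ (i , b) → testAt i (lookup c i) b)

    near-self : {k : ℕ} (c : Vec Ω k) → Sat q (near c) (assign c testParams)
    near-self c (i , b) = from (testAt-sat c i (lookup c i) b) (holds (test (lookup c i) b))

    near-sound : {k : ℕ} (c v : Vec Ω k) → Sat q (near c) (assign v testParams) →
                 Pointwise (_∼_ q) c v
    near-sound c v s = extensional⇒inductive (ext λ i →
      sound (test (lookup c i) (lookup v i))
        (to (testAt-sat v i (lookup c i) (lookup v i)) (s (i , lookup v i))))

    invariant⇒definable : {k : ℕ} (R : Vec Ω k → Set) → Invariant (_∼_ q) R → Definable q R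
    invariant⇒definable {k} R inv =
      TestPar , disj (Σ (Vec Ω k) R) (λ (c , _) → near c) , testParams ,
      λ v → mk⇔ (λ Rv → (v , Rv) , near-self v)
                (λ ((c , Rc) , s) → inv c v Rc (near-sound c v s))

proposition13 : ({ℓ : Level} → ExcludedMiddle ℓ) →
    (Ω : Set) (q : Ops Ω) →
    ((k : ℕ) (R : Vec Ω k → Set) → Definable q R ⇔ Invariant (_∼_ q) R)
    × ({l : ℕ} (ks : Fin l → ℕ) (Q : Quantifier Ω ks) → IsExtensional Q →
    (R : (i : Fin l) → Vec Ω (ks i) → Set) →
    Restrict q Q R ⇔ cupQ (quotQ (_∼_ q) Q) R)
proposition13 em Ω q = part1 , part2
  where
  open Classical q em using (invariant⇒definable)

  part1 : (k : ℕ) (R : Vec Ω k → Set) → Definable q R ⇔ Invariant (_∼_ q) R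
  part1 k R = mk⇔ (definable⇒invariant q R) (invariant⇒definable R)

  part2 : {l : ℕ} (ks : Fin l → ℕ) (Q : Quantifier Ω ks) → IsExtensional Q →
    (R : (i : Fin l) → Vec Ω (ks i) → Set) →
    Restrict q Q R ⇔ cupQ (quotQ (_∼_ q) Q) R
  part2 ks Q Q-ext R = mk⇔
    (λ (QR , R-def) →
      (λ i → R i , definable⇒invariant q (R i) (R-def i)) , QR , (λ i v → mk⇔ id id))
    (λ (R′ , QR′ , R⇔R′) →
      Q-ext (λ i → proj₁ (R′ i)) R (λ i v → ⇔-sym (R⇔R′ i v)) QR′ ,
      λ i → let (P , φ , p , R′⇔φ) = invariant⇒definable (proj₁ (R′ i)) (proj₂ (R′ i))
            in P , φ , p , λ v → R′⇔φ v ⇔-∘ R⇔R′ i v)
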